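{- Let $n,k$ be integers with $2\le 2k\le n-4$. Let $\eta=(\eta_1<\dots<\eta_l)\in\overline{\mathbb{D}}^{\,\mathrm{o}}_{2k+2}$, let $Y_{\eta^*}$ be the Young diagram whose main diagonal consists of exactly the $l+1$ cells $c_{1,1},\dots,c_{l+1,l+1}$ with $h_{1,1}=2n-5$, $h_{i,i}=\eta_{l-(i-2)}$ ($2\le i\le l+1$) and $a(c_{i,i})=l(c_{i,i})$ ($1\le i\le l+1$), and let $\lambda$ be the partition whose parts are the hook lengths of the first-column cells of $Y_{\eta^*}$. Then $\lambda$ is a partition of $T_{n,n-2k}=n(n+1)/2-(n-2k)$.
   Context: $\mathbb{D}^{\,\mathrm{o}}_N$ is the set of partitions of $N$ into distinct odd parts with at least two parts. $\overline{\mathbb{D}}^{\,\mathrm{o}}_{2k+2}=\mathbb{D}^{\,\mathrm{o}}_{2k+2}\setminus\{(1,2k+1)\}$ if $2k=n-4$, and $=\mathbb{D}^{\,\mathrm{o}}_{2k+2}$ otherwise. Young diagrams in English convention; $c_{i,j}$ is the cell in row $i$, column $j$; arm $a$ = cells to the right, leg $l$ = cells below, $h_{i,j}=a(c_{i,j})+l(c_{i,j})+1$. -}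

module Defs where

open import Data.Nat using (ℕ; zero; suc; _+_; _*_; _∸_; _≤_; _<_; _≥_)
open import Data.Nat.DivMod using (_%_)
open import Data.Nat.ListAction using (sum)
open import Data.List using (List; []; _∷_; length; applyUpTo; reverse)
open import Data.List.Relation.Unary.All using (All)
open import Data.List.Relation.Unary.Linked using (Linked)
open import Data.Product using (_×_)
open import Relation.Binary.PropositionalEquality using (_≡_; _≢_)
open import Relation.Nullary using (¬_)

-- A partition (= Young diagram, given by its row lengths, English convention):
-- a weakly decreasing list of positive integers.
IsPartition : List ℕ → Set
IsPartition μ = Linked _≥_ μ × All (λ p → 0 < p) μ

IsPartitionOf : List ℕ → ℕ → Set
IsPartitionOf μ N = IsPartition μ × sum μ ≡ N

Odd : ℕ → Set
Odd m = m % 2 ≡ 1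

InDo : ℕ → List ℕ → Set
InDo N η = Linked _<_ η × All Odd η × 2 ≤ length η × sum η ≡ N

InDoBar : ℕ → ℕ → List ℕ → Set
InDoBar n k η = InDo (2 * k + 2) η × (2 * k + 4 ≡ n → η ≢ (1 ∷ (2 * k + 1) ∷ []))

-- 1-indexed access with default 0 (used only for in-range indices).
nth : List ℕ → ℕ → ℕ
nth []       _             = 0
nth (x ∷ xs) zero          = 0
nth (x ∷ xs) (suc zero)    = x
nth (x ∷ xs) (suc (suc i)) = nth xs (suc i)

rowLen : List ℕ → ℕ → ℕ
rowLen μ i = nth μ i

colLen : List ℕ → ℕ → ℕ
colLen []       j = 0
colLen (r ∷ μ) j with j Data.Nat.≤? r
... | Relation.Nullary.yes _ = suc (colLen μ j)
... | Relation.Nullary.no  _ = colLen μ j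

InDiagram : List ℕ → ℕ → ℕ → Set
InDiagram μ i j = 1 ≤ i × 1 ≤ j × j ≤ rowLen μ i

arm : List ℕ → ℕ → ℕ → ℕ
arm μ i j = rowLen μ i ∸ j

leg : List ℕ → ℕ → ℕ → ℕ
leg μ i j = colLen μ j ∸ i

hook : List ℕ → ℕ → ℕ → ℕ
hook μ i j = arm μ i j + leg μ i j + 1

DiagonalSize : List ℕ → ℕ → Set
DiagonalSize μ d = (∀ i → 1 ≤ i → i ≤ d → InDiagram μ i i) × ¬ InDiagram μ (suc d) (suc d)

IsYEtaStar : ℕ → List ℕ → List ℕ → Set
IsYEtaStar n η μ =
  IsPartition μ ×
  DiagonalSize μ (suc (length η)) ×
  hook μ 1 1 ≡ 2 * n ∸ 5 ×
  (∀ i → 2 ≤ i → i ≤ suc (length η) → hook μ i i ≡ nth (reverse η) (i ∸ 1)) ×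
  (∀ i → 1 ≤ i → i ≤ suc (length η) → arm μ i i ≡ leg μ i i)

firstColumnHooks : List ℕ → List ℕ
firstColumnHooks μ = applyUpTo (λ i → hook μ (suc i) 1) (length μ)

tri : ℕ → ℕ
tri zero    = 0
tri (suc n) = suc n + tri n

T : ℕ → ℕ → ℕ
T n m = tri n ∸ m

{-# OPTIONS --safe #-}
module Submission where

-- Y_{η*} is the self-conjugate diagram with Frobenius coordinates (a | a),
-- a = (n − 3, (η_l − 1)/2, …, (η_1 − 1)/2); these are strictly decreasing because every
-- η_i ≤ 2k + 2 < 2n − 5, and the diagram is built by wrapping hooks around one another.
-- Conversely, removing the first row and column of any such μ shows that |μ| is the sum of its
-- diagonal hooks, (2n − 5) + |η| = 2n − 3 + 2k, while arm = leg at c₁₁ forces n − 2 rows.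
-- The first-column hook of row i is μ_i + (n − 2 − i), so these hooks add up to
-- |μ| + (n − 3)(n − 2)/2 = n(n + 1)/2 − (n − 2k).

open import Defs
open import Data.Empty using (⊥-elim)
open import Data.Nat
  using (ℕ; zero; suc; _+_; _*_; _∸_; _/_; _≤_; _<_; _≥_; _>_; z≤n; s≤s; s≤s⁻¹; z<s; s<s; _≤?_; _%_)
open import Data.Nat.Properties
open import Data.Nat.DivMod using (m≡m%n+[m/n]*n; /-monoˡ-≤; m*n/n≡m)
open import Data.Nat.ListAction using (sum)
open import Data.Nat.ListAction.Properties using (sum-↭)
open import Data.Nat.Tactic.RingSolver using (solve-∀)
open import Data.List using (List; []; _∷_; length; applyUpTo; reverse; reverseAcc; map; foldr; _++_; replicate)
open import Data.List.Properties using (length-map; length-reverse; length-++; length-replicate; map-∘; map-id)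
open import Data.List.Relation.Unary.All as All using (All; []; _∷_)
import Data.List.Relation.Unary.All.Properties as All
open import Data.List.Relation.Unary.Linked as Linked using (Linked; []; [-]; _∷_)
import Data.List.Relation.Unary.Linked.Properties as Linked
open import Data.List.Relation.Binary.Permutation.Propositional using (↭-sym)
open import Data.List.Relation.Binary.Permutation.Propositional.Properties using (↭-reverse; All-resp-↭)
open import Data.Product using (Σ; _×_; _,_; proj₁; proj₂)
open import Function using (_∘_; flip; _⇔_; mk⇔; Equivalence)
open import Relation.Binary.PropositionalEquality
open import Relation.Nullary using (yes; no)

open ≡-Reasoning

applyUpTo-cong : ∀ {A : Set} {f g : ℕ → A} n → (∀ {i} → i < n → f i ≡ g i) →
                 applyUpTo f n ≡ applyUpTo g n
applyUpTo-cong zero    f≗g = refl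
applyUpTo-cong (suc n) f≗g = cong₂ _∷_ (f≗g z<s) (applyUpTo-cong n (f≗g ∘ s<s))

applyUpTo-nth : ∀ xs → applyUpTo (nth xs ∘ suc) (length xs) ≡ xs
applyUpTo-nth []       = refl
applyUpTo-nth (x ∷ xs) = cong (x ∷_) (applyUpTo-nth xs)

nth-map : ∀ (f : ℕ → ℕ) → f 0 ≡ 0 → ∀ xs i → nth (map f xs) i ≡ f (nth xs i)
nth-map f f0≡0 []       i             = sym f0≡0
nth-map f f0≡0 (x ∷ xs) zero          = sym f0≡0
nth-map f f0≡0 (x ∷ xs) (suc zero)    = refl
nth-map f f0≡0 (x ∷ xs) (suc (suc i)) = nth-map f f0≡0 xs (suc i)

nth-All : ∀ {P : ℕ → Set} {xs} → All P xs → ∀ {i} → i < length xs → P (nth xs (suc i))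
nth-All (px ∷ _)  {zero}  _         = px
nth-All (_ ∷ pxs) {suc i} (s≤s i<n) = nth-All pxs i<n

nth-++-zeros : ∀ ν r i → nth (ν ++ replicate r 0) i ≡ nth ν i
nth-++-zeros []      zero    i             = refl
nth-++-zeros []      (suc r) zero          = refl
nth-++-zeros []      (suc r) (suc zero)    = refl
nth-++-zeros []      (suc r) (suc (suc i)) = nth-++-zeros [] r (suc i)
nth-++-zeros (y ∷ ν) r       zero          = refl
nth-++-zeros (y ∷ ν) r       (suc zero)    = refl
nth-++-zeros (y ∷ ν) r       (suc (suc i)) = nth-++-zeros ν r (suc i)

All-reverse : ∀ {P : ℕ → Set} {xs} → All P xs → All P (reverse xs)
All-reverse {xs = xs} = All-resp-↭ (↭-sym (↭-reverse xs))

All-≤-sum : ∀ xs → All (_≤ sum xs) xs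
All-≤-sum []       = []
All-≤-sum (x ∷ xs) =
  m≤m+n x (sum xs) ∷ All.map (λ y≤ → ≤-trans y≤ (m≤n+m (sum xs) x)) (All-≤-sum xs)

Linked-∷ : ∀ {R : ℕ → ℕ → Set} {x ys} → All (R x) ys → Linked R ys → Linked R (x ∷ ys)
Linked-∷ []      _  = [-]
Linked-∷ (r ∷ _) ys = r ∷ ys

Linked-∷-nth : ∀ {x ys} → nth ys 1 ≤ x → Linked _≥_ ys → Linked _≥_ (x ∷ ys)
Linked-∷-nth {ys = []}    _     _  = [-]
Linked-∷-nth {ys = _ ∷ _} y≤x ys = y≤x ∷ ys

Linked-reverse : ∀ {R : ℕ → ℕ → Set} {xs} → Linked R xs → Linked (flip R) (reverse xs)
Linked-reverse []  = []
Linked-reverse [-] = [-]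
Linked-reverse (r ∷ rs) = go (r ∷ [-]) rs
  where
  go : ∀ {R : ℕ → ℕ → Set} {y acc ys} → Linked (flip R) (y ∷ acc) → Linked R (y ∷ ys) →
       Linked (flip R) (reverseAcc (y ∷ acc) ys)
  go acc [-]      = acc
  go acc (r ∷ rs) = go (r ∷ acc) rs

Linked-zeros : ∀ r → Linked _≥_ (replicate r 0)
Linked-zeros zero          = []
Linked-zeros (suc zero)    = [-]
Linked-zeros (suc (suc r)) = z≤n ∷ Linked-zeros (suc r)

Linked-++-zeros : ∀ {ν} r → Linked _≥_ ν → Linked _≥_ (ν ++ replicate r 0)
Linked-++-zeros r       []         = Linked-zeros r
Linked-++-zeros zero    [-]        = [-]
Linked-++-zeros (suc r) [-]        = z≤n ∷ Linked-zeros (suc r)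
Linked-++-zeros r       (y≤x ∷ ys) = y≤x ∷ Linked-++-zeros r ys

sum-zeros : ∀ {xs} → Linked _≥_ (0 ∷ xs) → sum (0 ∷ xs) ≡ 0
sum-zeros [-]       = refl
sum-zeros (z≤n ∷ L) = sum-zeros L

nth-suc-≤ : ∀ {μ} → Linked _≥_ μ → ∀ i → nth μ (suc (suc i)) ≤ nth μ (suc i)
nth-suc-≤ []         i       = z≤n
nth-suc-≤ [-]        i       = z≤n
nth-suc-≤ (y≤x ∷ _)  zero    = y≤x
nth-suc-≤ (_ ∷ L)    (suc i) = nth-suc-≤ L i

nth-≤-nth-1 : ∀ {μ} → Linked _≥_ μ → ∀ i → nth μ (suc i) ≤ nth μ 1
nth-≤-nth-1 L zero    = ≤-refl
nth-≤-nth-1 L (suc i) = ≤-trans (nth-suc-≤ L i) (nth-≤-nth-1 L i)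

colLen-≤ : ∀ {j x} xs → j ≤ x → colLen (x ∷ xs) j ≡ suc (colLen xs j)
colLen-≤ {j} {x} xs j≤x with j ≤? x
... | yes _   = refl
... | no j≰x = ⊥-elim (j≰x j≤x)

colLen-1 : ∀ {μ} → All (0 <_) μ → colLen μ 1 ≡ length μ
colLen-1 []                   = refl
colLen-1 {x ∷ xs} (0<x ∷ ps) = trans (colLen-≤ xs 0<x) (cong suc (colLen-1 ps))

colLen-++-zeros : ∀ ν r j → colLen (ν ++ replicate r 0) (suc j) ≡ colLen ν (suc j)
colLen-++-zeros []      zero    j = refl
colLen-++-zeros []      (suc r) j = colLen-++-zeros [] r j
colLen-++-zeros (y ∷ ν) r       j with suc j ≤? y
... | yes _ = cong suc (colLen-++-zeros ν r j)
... | no _  = colLen-++-zeros ν r j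

hook-positive : ∀ μ i j → 0 < hook μ i j
hook-positive μ i j = m≤n+m 1 (arm μ i j + leg μ i j)

firstColumnHooks-isPartition : ∀ {μ} → Linked _≥_ μ → IsPartition (firstColumnHooks μ)
firstColumnHooks-isPartition {μ} L =
  Linked.applyUpTo⁺₂ _ (length μ) hook-antitone ,
  All.applyUpTo⁺₂ _ (length μ) (λ i → hook-positive μ (suc i) 1)
  where
  hook-antitone : ∀ i → hook μ (suc i) 1 ≥ hook μ (suc (suc i)) 1
  hook-antitone i = +-monoˡ-≤ 1 (+-mono-≤ (∸-monoˡ-≤ 1 (nth-suc-≤ L i))
                                          (∸-monoʳ-≤ (colLen μ 1) (n≤1+n (suc i))))

firstColumnHooks-∷ : ∀ {x xs} → 0 < x → All (0 <_) xs →
                     firstColumnHooks (x ∷ xs) ≡ x + length xs ∷ firstColumnHooks xs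
firstColumnHooks-∷ {suc x} {xs} 0<x ps =
  cong₂ _∷_ corner (applyUpTo-cong (length xs) (λ _ → below))
  where
  corner : hook (suc x ∷ xs) 1 1 ≡ suc x + length xs
  corner rewrite colLen-1 ps = +-comm (x + length xs) 1
  below : ∀ {i} → hook (suc x ∷ xs) (suc (suc i)) 1 ≡ hook xs (suc i) 1
  below = refl

sum-firstColumnHooks : ∀ {x xs} → All (0 <_) (x ∷ xs) →
                       sum (firstColumnHooks (x ∷ xs)) ≡ sum (x ∷ xs) + tri (length xs)
sum-firstColumnHooks {x} {[]}     (0<x ∷ []) = cong sum (firstColumnHooks-∷ 0<x [])
sum-firstColumnHooks {x} {y ∷ ys} (0<x ∷ ps) = begin
  sum (firstColumnHooks (x ∷ y ∷ ys))                 ≡⟨ cong sum (firstColumnHooks-∷ 0<x ps) ⟩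
  x + suc l + sum (firstColumnHooks (y ∷ ys))         ≡⟨ cong (x + suc l +_) (sum-firstColumnHooks ps) ⟩
  x + suc l + (sum (y ∷ ys) + tri l)                  ≡⟨ shuffle x l (sum (y ∷ ys)) (tri l) ⟩
  x + sum (y ∷ ys) + (suc l + tri l)                  ∎
  where
  l = length ys
  shuffle : ∀ x l s t → x + suc l + (s + t) ≡ x + s + (suc l + t)
  shuffle = solve-∀

-- Removing the first row and column

dropFirstColumn : List ℕ → List ℕ
dropFirstColumn = map (_∸ 1)

1+m≤n∸1⇔1+m<n : ∀ {m n} → suc m ≤ n ∸ 1 ⇔ suc m < n
1+m≤n∸1⇔1+m<n {n = zero}  = mk⇔ (λ ()) (λ ())
1+m≤n∸1⇔1+m<n {n = suc n} = mk⇔ s≤s s≤s⁻¹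

colLen-dropFirstColumn : ∀ xs j → colLen (dropFirstColumn xs) (suc j) ≡ colLen xs (suc (suc j))
colLen-dropFirstColumn []       j = refl
colLen-dropFirstColumn (x ∷ xs) j with suc j ≤? x ∸ 1 | suc (suc j) ≤? x
... | yes _ | yes _ = cong suc (colLen-dropFirstColumn xs j)
... | no _  | no _  = colLen-dropFirstColumn xs j
... | yes p | no q  = ⊥-elim (q (Equivalence.to 1+m≤n∸1⇔1+m<n p))
... | no p  | yes q = ⊥-elim (p (Equivalence.from 1+m≤n∸1⇔1+m<n q))

sum-dropFirstColumn : ∀ xs → sum xs ≡ sum (dropFirstColumn xs) + colLen xs 1
sum-dropFirstColumn []           = refl
sum-dropFirstColumn (zero ∷ xs)  = sum-dropFirstColumn xs
sum-dropFirstColumn (suc x ∷ xs) = begin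
  suc x + sum xs                                   ≡⟨ cong (suc x +_) (sum-dropFirstColumn xs) ⟩
  suc x + (sum (dropFirstColumn xs) + colLen xs 1) ≡⟨ shuffle x _ _ ⟩
  x + sum (dropFirstColumn xs) + suc (colLen xs 1) ∎
  where
  shuffle : ∀ x s c → suc x + (s + c) ≡ x + s + suc c
  shuffle = solve-∀

arm-peel : ∀ x xs i →
           arm (x ∷ xs) (suc (suc i)) (suc (suc i)) ≡ arm (dropFirstColumn xs) (suc i) (suc i)
arm-peel x xs i = sym (begin
  nth (dropFirstColumn xs) (suc i) ∸ suc i ≡⟨ cong (_∸ suc i) (nth-map (_∸ 1) refl xs (suc i)) ⟩
  nth xs (suc i) ∸ 1 ∸ suc i               ≡⟨ ∸-+-assoc (nth xs (suc i)) 1 (suc i) ⟩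
  nth xs (suc i) ∸ suc (suc i)             ∎)

leg-peel : ∀ {x} xs i → suc (suc i) ≤ x →
           leg (x ∷ xs) (suc (suc i)) (suc (suc i)) ≡ leg (dropFirstColumn xs) (suc i) (suc i)
leg-peel xs i i≤x rewrite colLen-≤ xs i≤x = sym (cong (_∸ suc i) (colLen-dropFirstColumn xs i))

diagonal-≤-head : ∀ {x xs i} → Linked _≥_ (x ∷ xs) → InDiagram (x ∷ xs) (suc i) (suc i) → suc i ≤ x
diagonal-≤-head {i = i} L (_ , _ , i≤row) = ≤-trans i≤row (nth-≤-nth-1 L i)

InDiagram-peel : ∀ x xs i →
  InDiagram (x ∷ xs) (suc (suc i)) (suc (suc i)) ⇔ InDiagram (dropFirstColumn xs) (suc i) (suc i)
InDiagram-peel x xs i = mk⇔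
  (λ (_ , _ , i<row) → s≤s z≤n , s≤s z≤n , subst (suc i ≤_) (sym row-peel) (from 1+m≤n∸1⇔1+m<n i<row))
  (λ (_ , _ , i≤row) → s≤s z≤n , s≤s z≤n , to 1+m≤n∸1⇔1+m<n (subst (suc i ≤_) row-peel i≤row))
  where
  open Equivalence
  row-peel : nth (dropFirstColumn xs) (suc i) ≡ nth xs (suc i) ∸ 1
  row-peel = nth-map (_∸ 1) refl xs (suc i)

DiagonalSize-peel : ∀ {x} xs d → 0 < x →
  DiagonalSize (x ∷ xs) (suc d) ⇔ DiagonalSize (dropFirstColumn xs) d
DiagonalSize-peel {x} xs d 0<x = mk⇔
  (λ (cells , edge) →
     (λ { (suc i) _ i≤d → to (InDiagram-peel x xs i) (cells (suc (suc i)) (s≤s z≤n) (s≤s i≤d)) }) ,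
     edge ∘ from (InDiagram-peel x xs d))
  (λ (cells , edge) →
     (λ { (suc zero) _ _ → s≤s z≤n , s≤s z≤n , 0<x
        ; (suc (suc i)) _ (s≤s i<d) → from (InDiagram-peel x xs i) (cells (suc i) (s≤s z≤n) i<d) }) ,
     edge ∘ to (InDiagram-peel x xs d))
  where open Equivalence

diagonalHooks : List ℕ → ℕ → List ℕ
diagonalHooks μ d = applyUpTo (λ i → hook μ (suc i) (suc i)) d

-- Frobenius: peeling off the first row and column removes exactly the hook of c₁₁.
sum≡sum-diagonalHooks : ∀ {μ} d → Linked _≥_ μ → DiagonalSize μ d → sum μ ≡ sum (diagonalHooks μ d)
sum≡sum-diagonalHooks {[]}         zero    _ _ = refl
sum≡sum-diagonalHooks {zero ∷ xs}  zero    L _ = sum-zeros L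
sum≡sum-diagonalHooks {suc x ∷ xs} zero    _ (_ , no-c₁₁) =
  ⊥-elim (no-c₁₁ (s≤s z≤n , s≤s z≤n , s≤s z≤n))
sum≡sum-diagonalHooks {[]}         (suc d) _ (cells , _) with cells 1 (s≤s z≤n) (s≤s z≤n)
... | _ , _ , ()
sum≡sum-diagonalHooks {zero ∷ xs}  (suc d) _ (cells , _) with cells 1 (s≤s z≤n) (s≤s z≤n)
... | _ , _ , ()
sum≡sum-diagonalHooks {suc x ∷ xs} (suc d) L D = begin
  suc x + sum xs
    ≡⟨ cong (suc x +_) (sum-dropFirstColumn xs) ⟩
  suc x + (sum (dropFirstColumn xs) + colLen xs 1)
    ≡⟨ cong (λ s → suc x + (s + colLen xs 1)) inner ⟩
  suc x + (sum (diagonalHooks (dropFirstColumn xs) d) + colLen xs 1)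
    ≡⟨ shuffle x _ (colLen xs 1) ⟩
  hook μ 1 1 + sum (diagonalHooks (dropFirstColumn xs) d)
    ≡⟨ cong (λ hs → hook μ 1 1 + sum hs) (applyUpTo-cong d peeled) ⟨
  hook μ 1 1 + sum (applyUpTo (λ i → hook μ (suc (suc i)) (suc (suc i))) d)
    ∎
  where
  μ = suc x ∷ xs
  inner : sum (dropFirstColumn xs) ≡ sum (diagonalHooks (dropFirstColumn xs) d)
  inner = sum≡sum-diagonalHooks d (Linked.map⁺ (Linked.map (∸-monoˡ-≤ 1) (Linked.tail L)))
                                  (Equivalence.to (DiagonalSize-peel xs d z<s) D)
  peeled : ∀ {i} → i < d → hook μ (suc (suc i)) (suc (suc i)) ≡ hook (dropFirstColumn xs) (suc i) (suc i)
  peeled {i} i<d = cong₂ (λ a l → a + l + 1) (arm-peel (suc x) xs i)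
    (leg-peel xs i (diagonal-≤-head L (proj₁ D (suc (suc i)) (s≤s z≤n) (s≤s i<d))))
  shuffle : ∀ x s c → suc x + (s + c) ≡ x + c + 1 + s
  shuffle = solve-∀

-- Diagrams with prescribed Frobenius coordinates

FrobeniusCoordinates : List ℕ → List ℕ → Set
FrobeniusCoordinates μ as =
  DiagonalSize μ (length as) ×
  (∀ i → 1 ≤ i → i ≤ length as → arm μ i i ≡ nth as i × leg μ i i ≡ nth as i)

hook-FrobeniusCoordinates : ∀ {μ as} → FrobeniusCoordinates μ as →
  ∀ i → 1 ≤ i → i ≤ length as → hook μ i i ≡ nth as i + nth as i + 1
hook-FrobeniusCoordinates (_ , arm-leg) i 1≤i i≤d =
  cong₂ (λ a l → a + l + 1) (proj₁ (arm-leg i 1≤i i≤d)) (proj₂ (arm-leg i 1≤i i≤d))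

FrobeniusCoordinates-++-zeros : ∀ {ν as} r → FrobeniusCoordinates ν as →
                                FrobeniusCoordinates (ν ++ replicate r 0) as
FrobeniusCoordinates-++-zeros {ν} r ((cells , edge) , arm-leg) =
  ((λ i 1≤i i≤d → cell⇐ (cells i 1≤i i≤d)) , edge ∘ cell⇒) ,
  λ { i@(suc j) 1≤i i≤d →
        trans (cong (_∸ i) (nth-++-zeros ν r i)) (proj₁ (arm-leg i 1≤i i≤d)) ,
        trans (cong (_∸ i) (colLen-++-zeros ν r j)) (proj₂ (arm-leg i 1≤i i≤d)) }
  where
  cell⇒ : ∀ {i j} → InDiagram (ν ++ replicate r 0) i j → InDiagram ν i j
  cell⇒ {i} (1≤i , 1≤j , j≤row) = 1≤i , 1≤j , subst (_ ≤_) (nth-++-zeros ν r i) j≤row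
  cell⇐ : ∀ {i j} → InDiagram ν i j → InDiagram (ν ++ replicate r 0) i j
  cell⇐ {i} (1≤i , 1≤j , j≤row) = 1≤i , 1≤j , subst (_ ≤_) (sym (nth-++-zeros ν r i)) j≤row

pad : ℕ → List ℕ → List ℕ
pad a ν = ν ++ replicate (a ∸ length ν) 0

-- The new first row and column, both of length a + 1, wrap around ν padded with empty rows;
-- so c₁₁ gets arm = leg = a and the diagonal of ν moves down by one.
addHook : ℕ → List ℕ → List ℕ
addHook a ν = suc a ∷ map suc (pad a ν)

length-addHook : ∀ {a ν} → length ν ≤ a → length (addHook a ν) ≡ suc a
length-addHook {a} {ν} ν≤a = cong suc (begin
  length (map suc (pad a ν))                      ≡⟨ length-map suc (pad a ν) ⟩
  length (ν ++ replicate (a ∸ length ν) 0)        ≡⟨ length-++ ν ⟩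
  length ν + length (replicate (a ∸ length ν) 0)  ≡⟨ cong (length ν +_) (length-replicate _) ⟩
  length ν + (a ∸ length ν)                       ≡⟨ m+[n∸m]≡n ν≤a ⟩
  a                                               ∎)

addHook-positive : ∀ a ν → All (0 <_) (addHook a ν)
addHook-positive a ν = z<s ∷ All.map⁺ {f = suc} (All.universal (λ _ → z<s) (pad a ν))

addHook-linked : ∀ {a ν} → Linked _≥_ ν → nth ν 1 ≤ a → Linked _≥_ (addHook a ν)
addHook-linked {a} {ν} ν↓ ν₁≤a =
  Linked-∷-nth second-row≤ (Linked.map⁺ (Linked.map s≤s (Linked-++-zeros (a ∸ length ν) ν↓)))
  where
  second-row≤ : nth (map suc (pad a ν)) 1 ≤ suc a
  second-row≤ with pad a ν | nth-++-zeros ν (a ∸ length ν) 1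
  ... | []    | _    = z≤n
  ... | _ ∷ _ | refl = s≤s ν₁≤a

addHook-FrobeniusCoordinates : ∀ {a ν as} → Linked _≥_ ν → length ν ≤ a → nth ν 1 ≤ a →
  FrobeniusCoordinates ν as → FrobeniusCoordinates (addHook a ν) (a ∷ as)
addHook-FrobeniusCoordinates {a} {ν} {as} ν↓ ν≤a ν₁≤a ν-coords = diagonal , arm-leg
  where
  μ = addHook a ν
  inner : dropFirstColumn (map suc (pad a ν)) ≡ pad a ν
  inner = trans (sym (map-∘ {g = _∸ 1} {f = suc} (pad a ν))) (map-id (pad a ν))
  inner-coords : FrobeniusCoordinates (dropFirstColumn (map suc (pad a ν))) as
  inner-coords = subst (λ ρ → FrobeniusCoordinates ρ as) (sym inner)
                       (FrobeniusCoordinates-++-zeros {ν} {as} (a ∸ length ν) ν-coords)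
  diagonal : DiagonalSize μ (suc (length as))
  diagonal = Equivalence.from (DiagonalSize-peel (map suc (pad a ν)) (length as) z<s) (proj₁ inner-coords)
  first-leg : leg μ 1 1 ≡ a
  first-leg = trans (colLen-1 (All.tail (addHook-positive a ν))) (suc-injective (length-addHook {ν = ν} ν≤a))
  arm-leg : ∀ i → 1 ≤ i → i ≤ suc (length as) →
            arm μ i i ≡ nth (a ∷ as) i × leg μ i i ≡ nth (a ∷ as) i
  arm-leg (suc zero)    _ _         = refl , first-leg
  arm-leg (suc (suc i)) _ (s≤s i<d) =
    trans (arm-peel (suc a) (map suc (pad a ν)) i) (proj₁ inner-arm-leg) ,
    trans (leg-peel (map suc (pad a ν)) i i<a) (proj₂ inner-arm-leg)
    where
    inner-arm-leg = proj₂ inner-coords (suc i) (s≤s z≤n) i<d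
    i<a : suc (suc i) ≤ suc a
    i<a = diagonal-≤-head (addHook-linked ν↓ ν₁≤a) (proj₁ diagonal (suc (suc i)) (s≤s z≤n) (s≤s i<d))

frobeniusDiagram : List ℕ → List ℕ
frobeniusDiagram = foldr addHook []

frobeniusDiagram-first-row≤ : ∀ {a as} → Linked _>_ (a ∷ as) → nth (frobeniusDiagram as) 1 ≤ a
frobeniusDiagram-first-row≤ [-]       = z≤n
frobeniusDiagram-first-row≤ (b<a ∷ _) = b<a

frobeniusDiagram-rows≤ : ∀ {a as} → Linked _>_ (a ∷ as) → length (frobeniusDiagram as) ≤ a

length-frobeniusDiagram : ∀ {as} → Linked _>_ as → length (frobeniusDiagram as) ≡ nth (frobeniusDiagram as) 1
length-frobeniusDiagram {[]}     _  = refl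
length-frobeniusDiagram {a ∷ as} as↓ =
  length-addHook {ν = frobeniusDiagram as} (frobeniusDiagram-rows≤ as↓)

frobeniusDiagram-rows≤ as↓ =
  subst (_≤ _) (sym (length-frobeniusDiagram (Linked.tail as↓))) (frobeniusDiagram-first-row≤ as↓)

frobeniusDiagram-isPartition : ∀ {as} → Linked _>_ as → IsPartition (frobeniusDiagram as)
frobeniusDiagram-isPartition {[]}     _   = [] , []
frobeniusDiagram-isPartition {a ∷ as} as↓ =
  addHook-linked (proj₁ (frobeniusDiagram-isPartition (Linked.tail as↓))) (frobeniusDiagram-first-row≤ as↓) ,
  addHook-positive a (frobeniusDiagram as)

frobeniusDiagram-FrobeniusCoordinates : ∀ {as} → Linked _>_ as → FrobeniusCoordinates (frobeniusDiagram as) as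
frobeniusDiagram-FrobeniusCoordinates {[]}     _   =
  ((λ { _ (s≤s _) () }) , (λ { (_ , _ , ()) })) , (λ { _ (s≤s _) () })
frobeniusDiagram-FrobeniusCoordinates {a ∷ as} as↓ =
  addHook-FrobeniusCoordinates (proj₁ (frobeniusDiagram-isPartition (Linked.tail as↓)))
    (frobeniusDiagram-rows≤ as↓) (frobeniusDiagram-first-row≤ as↓)
    (frobeniusDiagram-FrobeniusCoordinates (Linked.tail as↓))

odd-half : ∀ {x} → Odd x → x / 2 + x / 2 + 1 ≡ x
odd-half {x} x-odd = begin
  x / 2 + x / 2 + 1   ≡⟨ double (x / 2) ⟩
  1 + x / 2 * 2       ≡⟨ cong (_+ x / 2 * 2) x-odd ⟨
  x % 2 + x / 2 * 2   ≡⟨ m≡m%n+[m/n]*n x 2 ⟨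
  x                   ∎
  where
  double : ∀ h → h + h + 1 ≡ 1 + h * 2
  double = solve-∀

half-< : ∀ {x y} → Odd x → Odd y → x < y → x / 2 < y / 2
half-< {x} {y} x-odd y-odd x<y = ≰⇒> λ y/2≤x/2 →
  <⇒≱ x<y (subst₂ _≤_ (odd-half y-odd) (odd-half x-odd)
                     (+-monoˡ-≤ 1 (+-mono-≤ y/2≤x/2 y/2≤x/2)))

half-bound : ∀ {n k x} → 2 ≤ 2 * k → 2 * k + 4 ≤ n → x ≤ 2 * k + 2 → x / 2 < n ∸ 3
half-bound {n} {suc k} {x} _ n≥ x≤ = ≤-<-trans half≤ (m+n≤o⇒m≤o∸n (suc (k + 2)) room)
  where
  as-product : ∀ k → 2 * suc k + 2 ≡ (k + 2) * 2
  as-product = solve-∀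
  as-sum : ∀ k → suc (k + 2) + 3 + k ≡ 2 * suc k + 4
  as-sum = solve-∀
  half≤ : x / 2 ≤ k + 2
  half≤ = ≤-trans (/-monoˡ-≤ 2 x≤) (≤-reflexive (trans (cong (_/ 2) (as-product k)) (m*n/n≡m (k + 2) 2)))
  room : suc (k + 2) + 3 ≤ n
  room = ≤-trans (m≤m+n (suc (k + 2) + 3) k) (≤-trans (≤-reflexive (as-sum k)) n≥)

double-∸3 : ∀ {n} → 3 ≤ n → (n ∸ 3) + (n ∸ 3) + 1 ≡ 2 * n ∸ 5
double-∸3 {suc zero}          (s≤s ())
double-∸3 {suc (suc zero)}    (s≤s (s≤s ()))
double-∸3 {suc (suc (suc m))} _ = sym (begin
  2 * (3 + m) ∸ 5          ≡⟨ cong (_∸ 5) (shift m) ⟩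
  5 + (m + m + 1) ∸ 5      ≡⟨ m+n∸m≡n 5 (m + m + 1) ⟩
  m + m + 1                ∎)
  where
  shift : ∀ m → 2 * (3 + m) ≡ 5 + (m + m + 1)
  shift = solve-∀

2k+4≤n⇒3≤n : ∀ {n} k → 2 * k + 4 ≤ n → 3 ≤ n
2k+4≤n⇒3≤n k = ≤-trans (≤-trans (n≤1+n 3) (m≤n+m 4 (2 * k)))

double-injective : ∀ {m p} → m + m ≡ p + p → m ≡ p
double-injective {m} {p} eq = *-cancelˡ-≡ m p 2 (begin
  2 * m     ≡⟨ cong (m +_) (+-identityʳ m) ⟩
  m + m     ≡⟨ eq ⟩
  p + p     ≡⟨ cong (p +_) (+-identityʳ p) ⟨
  2 * p     ∎)

2*n∸5≡2m+1⇒n≡3+m : ∀ {n m} → 3 ≤ n → m + m + 1 ≡ 2 * n ∸ 5 → n ≡ 3 + m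
2*n∸5≡2m+1⇒n≡3+m {n} {m} 3≤n eq with m≤n⇒∃[o]m+o≡n 3≤n
... | p , refl =
  cong (3 +_) (sym (double-injective (+-cancelʳ-≡ 1 (m + m) (p + p) (trans eq (sym (double-∸3 3≤n))))))

-- The summands are the corner hook, the other diagonal hooks, and the legs of the first column.
T-split : ∀ m k → 2 * k ≤ 3 + m → (m + m + 1) + (2 * k + 2) + tri m ≡ T (3 + m) (3 + m ∸ 2 * k)
T-split m k 2k≤ = sym (begin
  tri (3 + m) ∸ c                     ≡⟨ cong (_∸ c) total ⟨
  (m + m + 1) + (2 * k + 2) + tri m + c ∸ c ≡⟨ m+n∸n≡m _ c ⟩
  (m + m + 1) + (2 * k + 2) + tri m   ∎)
  where
  c = 3 + m ∸ 2 * k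
  regroup : ∀ m k t c → m + m + 1 + (2 * k + 2) + t + c ≡ m + m + 3 + t + (2 * k + c)
  regroup = solve-∀
  unfold-tri : ∀ m t → m + m + 3 + t + (3 + m) ≡ 3 + m + (2 + m + (1 + m + t))
  unfold-tri = solve-∀
  total : (m + m + 1) + (2 * k + 2) + tri m + c ≡ tri (3 + m)
  total = begin
    (m + m + 1) + (2 * k + 2) + tri m + c ≡⟨ regroup m k (tri m) c ⟩
    m + m + 3 + tri m + (2 * k + c)     ≡⟨ cong (m + m + 3 + tri m +_) (m+[n∸m]≡n 2k≤) ⟩
    m + m + 3 + tri m + (3 + m)         ≡⟨ unfold-tri m (tri m) ⟩
    tri (3 + m)                         ∎

-- The diagram Y_{η*}

-- Arm = leg = a gives the diagonal hook 2a + 1, so these are the Frobenius coordinates of Y_{η*}.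
yEtaStarCoordinates : ℕ → List ℕ → List ℕ
yEtaStarCoordinates n η = n ∸ 3 ∷ map (_/ 2) (reverse η)

yEtaStarCoordinates-decreasing : ∀ {n k η} → 2 ≤ 2 * k → 2 * k + 4 ≤ n →
  Linked _<_ η → All Odd η → sum η ≡ 2 * k + 2 → Linked _>_ (yEtaStarCoordinates n η)
yEtaStarCoordinates-decreasing {n} {k} {η} 2≤2k n≥ η↑ η-odd ∑η =
  Linked-∷ (All.map⁺ (All-reverse halves-small))
           (halves-decreasing (All-reverse η-odd) (Linked-reverse η↑))
  where
  halves-small : All (λ x → x / 2 < n ∸ 3) η
  halves-small = All.map (λ x≤ → half-bound {k = k} 2≤2k n≥ (subst (_ ≤_) ∑η x≤)) (All-≤-sum η)
  halves-decreasing : ∀ {xs} → All Odd xs → Linked _>_ xs → Linked _>_ (map (_/ 2) xs)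
  halves-decreasing _                              []        = []
  halves-decreasing _                              [-]       = [-]
  halves-decreasing (x-odd ∷ xs-odd@(y-odd ∷ _)) (y<x ∷ L) =
    half-< y-odd x-odd y<x ∷ halves-decreasing xs-odd L

yEtaStar-exists : ∀ {n k η} → 2 ≤ 2 * k → 2 * k + 4 ≤ n →
  Linked _<_ η → All Odd η → sum η ≡ 2 * k + 2 →
  IsYEtaStar n η (frobeniusDiagram (yEtaStarCoordinates n η))
yEtaStar-exists {n} {k} {η} 2≤2k n≥ η↑ η-odd ∑η =
  frobeniusDiagram-isPartition as↓ , subst (DiagonalSize μ) length-as (proj₁ coords) ,
  corner-hook , diagonal-hooks , arm≡leg
  where
  as = yEtaStarCoordinates n η
  μ = frobeniusDiagram as
  as↓ = yEtaStarCoordinates-decreasing {k = k} 2≤2k n≥ η↑ η-odd ∑η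
  coords = frobeniusDiagram-FrobeniusCoordinates as↓
  length-as : length as ≡ suc (length η)
  length-as = cong suc (trans (length-map (_/ 2) (reverse η)) (length-reverse η))
  in-range : ∀ {i} → i ≤ suc (length η) → i ≤ length as
  in-range {i} = subst (i ≤_) (sym length-as)
  corner-hook : hook μ 1 1 ≡ 2 * n ∸ 5
  corner-hook = trans (hook-FrobeniusCoordinates coords 1 (s≤s z≤n) (s≤s z≤n))
                      (double-∸3 (2k+4≤n⇒3≤n k n≥))
  diagonal-hooks : ∀ i → 2 ≤ i → i ≤ suc (length η) → hook μ i i ≡ nth (reverse η) (i ∸ 1)
  diagonal-hooks (suc zero)    (s≤s ()) _
  diagonal-hooks (suc (suc i)) _ i≤ = begin
    hook μ (suc (suc i)) (suc (suc i))
      ≡⟨ hook-FrobeniusCoordinates coords (suc (suc i)) (s≤s z≤n) (in-range i≤) ⟩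
    h + h + 1
      ≡⟨ cong (λ h → h + h + 1) (nth-map (_/ 2) refl (reverse η) (suc i)) ⟩
    y / 2 + y / 2 + 1
      ≡⟨ odd-half (nth-All (All-reverse η-odd) i<l) ⟩
    y
      ∎
    where
    h = nth as (suc (suc i))
    y = nth (reverse η) (suc i)
    i<l : i < length (reverse η)
    i<l = subst (i <_) (sym (length-reverse η)) (s≤s⁻¹ i≤)
  arm≡leg : ∀ i → 1 ≤ i → i ≤ suc (length η) → arm μ i i ≡ leg μ i i
  arm≡leg i 1≤i i≤ with proj₂ coords i 1≤i (in-range i≤)
  ... | arm≡a , leg≡a = trans arm≡a (sym leg≡a)

sum-yEtaStar : ∀ {n η μ} → IsYEtaStar n η μ → sum μ ≡ 2 * n ∸ 5 + sum η
sum-yEtaStar {n} {η} {μ} ((μ↓ , _) , diagonal , corner-hook , diagonal-hooks , _) = begin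
  sum μ
    ≡⟨ sum≡sum-diagonalHooks (suc (length η)) μ↓ diagonal ⟩
  sum (diagonalHooks μ (suc (length η)))
    ≡⟨ cong sum (cong₂ _∷_ corner-hook (applyUpTo-cong (length η) other-hooks)) ⟩
  2 * n ∸ 5 + sum (applyUpTo (nth (reverse η) ∘ suc) (length η))
    ≡⟨ cong (λ ys → 2 * n ∸ 5 + sum ys) tabulate-reverse ⟩
  2 * n ∸ 5 + sum (reverse η)
    ≡⟨ cong (2 * n ∸ 5 +_) (sum-↭ (↭-reverse η)) ⟩
  2 * n ∸ 5 + sum η
    ∎
  where
  other-hooks : ∀ {i} → i < length η → hook μ (suc (suc i)) (suc (suc i)) ≡ nth (reverse η) (suc i)
  other-hooks i<l = diagonal-hooks _ (s≤s (s≤s z≤n)) (s≤s i<l)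
  tabulate-reverse : applyUpTo (nth (reverse η) ∘ suc) (length η) ≡ reverse η
  tabulate-reverse = subst (λ l → applyUpTo (nth (reverse η) ∘ suc) l ≡ reverse η)
                           (length-reverse η) (applyUpTo-nth (reverse η))

corner-yEtaStar : ∀ {n η x xs} → IsYEtaStar n η (x ∷ xs) → length xs + length xs + 1 ≡ 2 * n ∸ 5
corner-yEtaStar {n} {η} {x} {xs} ((_ , positive) , _ , corner-hook , _ , arm≡leg) = begin
  length xs + length xs + 1   ≡⟨ cong (λ l → l + l + 1) first-leg ⟨
  leg μ 1 1 + leg μ 1 1 + 1   ≡⟨ cong (λ a → a + leg μ 1 1 + 1) (arm≡leg 1 (s≤s z≤n) (s≤s z≤n)) ⟨
  hook μ 1 1                  ≡⟨ corner-hook ⟩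
  2 * n ∸ 5                   ∎
  where
  μ = x ∷ xs
  first-leg : leg μ 1 1 ≡ length xs
  first-leg = cong (_∸ 1) (colLen-1 positive)

firstColumnHooks-yEtaStar : ∀ {n k η μ} → 2 * k + 4 ≤ n → sum η ≡ 2 * k + 2 →
  IsYEtaStar n η μ → IsPartitionOf (firstColumnHooks μ) (T n (n ∸ 2 * k))
firstColumnHooks-yEtaStar {μ = []} _ _ (_ , (cells , _) , _) with cells 1 (s≤s z≤n) (s≤s z≤n)
... | _ , _ , ()
firstColumnHooks-yEtaStar {n} {k} {η} {x ∷ xs} n≥ ∑η Y@((μ↓ , positive) , _) =
  firstColumnHooks-isPartition μ↓ , (begin
    sum (firstColumnHooks (x ∷ xs))
      ≡⟨ sum-firstColumnHooks positive ⟩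
    sum (x ∷ xs) + tri m
      ≡⟨ cong (_+ tri m) (sum-yEtaStar {n} {η} Y) ⟩
    2 * n ∸ 5 + sum η + tri m
      ≡⟨ cong (λ n → 2 * n ∸ 5 + sum η + tri m) rows ⟩
    2 * (3 + m) ∸ 5 + sum η + tri m
      ≡⟨ cong₂ (λ h s → h + s + tri m) (double-∸3 {3 + m} (s≤s (s≤s (s≤s z≤n)))) (sym ∑η) ⟨
    m + m + 1 + (2 * k + 2) + tri m
      ≡⟨ T-split m k (≤-trans (m≤m+n (2 * k) 4) (subst (_ ≤_) rows n≥)) ⟩
    T (3 + m) (3 + m ∸ 2 * k)
      ≡⟨ cong (λ n → T n (n ∸ 2 * k)) rows ⟨
    T n (n ∸ 2 * k)
      ∎)
  where
  m = length xs
  rows : n ≡ 3 + m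
  rows = 2*n∸5≡2m+1⇒n≡3+m (2k+4≤n⇒3≤n k n≥) (corner-yEtaStar {n} {η} Y)

proposition4p10 : (n k : ℕ) → 2 ≤ 2 * k → 2 * k + 4 ≤ n →
    (η : List ℕ) → InDoBar n k η →
    Σ (List ℕ) (IsYEtaStar n η) ×
    ((μ : List ℕ) → IsYEtaStar n η μ → IsPartitionOf (firstColumnHooks μ) (T n (n ∸ 2 * k)))
proposition4p10 n k 2≤2k n≥ η ((η↑ , η-odd , _ , ∑η) , _) =
  (frobeniusDiagram (yEtaStarCoordinates n η) , yEtaStar-exists {k = k} 2≤2k n≥ η↑ η-odd ∑η) ,
  λ μ → firstColumnHooks-yEtaStar {n} {k} {η} n≥ ∑η
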